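{- For all terms $M, M'$: if $M\bullet\iota = M'\bullet\iota$ (syntactic equality), then $M \sim_\alpha M'$.
   Context: Let $\mathcal{V}$ (the variables) be a type with decidable equality, together with $\mathrm{encode}:\mathcal{V}\to\mathbb{N}$ and $\mathrm{decode}:\mathbb{N}\to\mathcal{V}$ with $\mathrm{encode}(\mathrm{decode}\,n)=n$. Let $\mathcal{C}$ be any type. Terms: $\mathsf{c}\,k$ ($k\in\mathcal{C}$), $\mathsf{v}\,x$, $\lambda[x:A]M$, $\Pi[x:A]B$, $M\cdot N$. Free variables (as a list): $\mathrm{fv}(\mathsf{c}\,k)=[\,]$, $\mathrm{fv}(\mathsf{v}\,x)=[x]$, $\mathrm{fv}(\lambda[x:A]M)=\mathrm{fv}\,A \mathbin{++} (\mathrm{fv}\,M - x)$, likewise for $\Pi$, $\mathrm{fv}(M\cdot N)=\mathrm{fv}\,M\mathbin{++}\mathrm{fv}\,N$, where $xs-x$ deletes every occurrence of $x$. Substitutions are functions $\sigma:\mathcal{V}\to\Lambda$; $\iota\,x=\mathsf{v}\,x$; $(\sigma,x:=N)$ maps $x$ to $N$ and $y\ne x$ to $\sigma\,y$. Fix $\chi':\mathrm{List}\,\mathbb{N}\to\mathbb{N}$ with $\chi'(ns)\notin ns$; $X'(xs)=\mathrm{decode}(\chi'(\mathrm{map}\ \mathrm{encode}\ xs))$; $X(\sigma,xs)=X'$ of the concatenation of the $\mathrm{fv}(\sigma\,y)$, $y$ in $xs$. Substitution: $\mathsf{c}\,k\bullet\sigma=\mathsf{c}\,k$; $\mathsf{v}\,x\bullet\sigma=\sigma\,x$;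 $(M\cdot N)\bullet\sigma=(M\bullet\sigma)\cdot(N\bullet\sigma)$; $(\lambda[x:A]M)\bullet\sigma=\lambda[y:A\bullet\sigma](M\bullet(\sigma,x:=\mathsf{v}\,y))$ with $y=X(\sigma,\mathrm{fv}\,M-x)$; analogously for $\Pi$. Write $M[x:=N]=M\bullet(\iota,x:=N)$. Alpha-conversion $\sim_\alpha$ is the inductive relation with rules: $\mathsf{c}\,k\sim_\alpha\mathsf{c}\,k$; $\mathsf{v}\,x\sim_\alpha\mathsf{v}\,x$; if $M\sim_\alpha M'$ and $N\sim_\alpha N'$ then $M\cdot N\sim_\alpha M'\cdot N'$; if $A\sim_\alpha A'$, $y\notin\mathrm{fv}\,M-x$, $y\notin \mathrm{fv}\,M'-x'$ and $M[x:=\mathsf{v}\,y]= M'[x':=\mathsf{v}\,y]$ (syntactic equality), then $\lambda[x:A]M\sim_\alpha\lambda[x':A']M'$; and the same rule for $\Pi$ in place of $\lambda$. -}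

module Defs where

open import Data.Nat using (ℕ)
open import Data.List using (List; []; _∷_; _++_; map; concatMap; filter)
open import Data.List.Membership.Propositional using (_∈_; _∉_)
open import Relation.Nullary using (¬_; Dec; yes; no)
open import Relation.Nullary.Decidable using (¬?)
open import Relation.Binary using (DecidableEquality)
open import Relation.Binary.PropositionalEquality using (_≡_)

module Lambda
  (𝒱 : Set)
  (_≟_ : DecidableEquality 𝒱)
  (encode : 𝒱 → ℕ)
  (decode : ℕ → 𝒱)
  (encode-decode : ∀ n → encode (decode n) ≡ n)
  (𝒞 : Set)
  (χ' : List ℕ → ℕ)
  (χ'-fresh : ∀ ns → χ' ns ∉ ns)
  where

  infixl 6 _·_

  data Λ : Set where
    c    : 𝒞 → Λ
    v    : 𝒱 → Λ
    lam  : 𝒱 → Λ → Λ → Λ     -- lam x A M  is  λ[x:A]M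
    pi   : 𝒱 → Λ → Λ → Λ     -- pi x A B   is  Π[x:A]B
    _·_  : Λ → Λ → Λ

  _-_ : List 𝒱 → 𝒱 → List 𝒱
  xs - x = filter (λ y → ¬? (y ≟ x)) xs

  fv : Λ → List 𝒱
  fv (c k)       = []
  fv (v x)       = x ∷ []
  fv (lam x A M) = fv A ++ (fv M - x)
  fv (pi x A B)  = fv A ++ (fv B - x)
  fv (M · N)     = fv M ++ fv N

  Subst : Set
  Subst = 𝒱 → Λ

  ι : Subst
  ι x = v x

  _,_:=_ : Subst → 𝒱 → Λ → Subst
  (σ , x := N) y with y ≟ x
  ... | yes _ = N
  ... | no  _ = σ y

  X' : List 𝒱 → 𝒱
  X' xs = decode (χ' (map encode xs))

  X : Subst → List 𝒱 → 𝒱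
  X σ xs = X' (concatMap (λ y → fv (σ y)) xs)

  infixl 5 _•_

  _•_ : Λ → Subst → Λ
  c k • σ       = c k
  v x • σ       = σ x
  (M · N) • σ   = (M • σ) · (N • σ)
  lam x A M • σ = let y = X σ (fv M - x) in lam y (A • σ) (M • (σ , x := v y))
  pi x A B • σ  = let y = X σ (fv B - x) in pi y (A • σ) (B • (σ , x := v y))

  _[_:=_] : Λ → 𝒱 → Λ → Λ
  M [ x := N ] = M • (ι , x := N)

  infix 4 _∼α_

  data _∼α_ : Λ → Λ → Set where
    ∼c   : ∀ {k} → c k ∼α c k
    ∼v   : ∀ {x} → v x ∼α v x
    ∼app : ∀ {M M' N N'} → M ∼α M' → N ∼α N' → M · N ∼α M' · N'
    ∼lam : ∀ {x x' y A A' M M'} → A ∼α A'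
         → y ∉ fv M - x → y ∉ fv M' - x'
         → M [ x := v y ] ≡ M' [ x' := v y ]
         → lam x A M ∼α lam x' A' M'
    ∼pi  : ∀ {x x' y A A' B B'} → A ∼α A'
         → y ∉ fv B - x → y ∉ fv B' - x'
         → B [ x := v y ] ≡ B' [ x' := v y ]
         → pi x A B ∼α pi x' A' B'

-- Substituting ι only renames every binder to the canonical fresh name X ι (fv M - x).
-- So if M • ι ≡ M' • ι, corresponding binders of M and M' receive the same canonical
-- name y, which is fresh for both bodies because χ' avoids its argument, and the
-- renamed bodies coincide: this is exactly the premise of the binder rules of ∼α.
module Submission where

open import Defs
open import Data.Nat using (ℕ)
open import Data.List using (List; map)
open import Data.List.Properties using (concatMap-pure)
open import Data.List.Membership.Propositional using (_∉_; _∈_)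
open import Data.List.Membership.Propositional.Properties using (∈-map⁺)
open import Data.Product using (_×_; _,_)
open import Relation.Binary using (DecidableEquality)
open import Relation.Binary.PropositionalEquality using (_≡_; refl; sym; cong; subst)

module CanonicalNames
    (𝒱 : Set) (_≟_ : DecidableEquality 𝒱) (encode : 𝒱 → ℕ) (decode : ℕ → 𝒱)
    (encode-decode : ∀ n → encode (decode n) ≡ n) (𝒞 : Set)
    (χ' : List ℕ → ℕ) (χ'-fresh : ∀ ns → χ' ns ∉ ns) where
  open Lambda 𝒱 _≟_ encode decode encode-decode 𝒞 χ' χ'-fresh

  X'-fresh : (xs : List 𝒱) → X' xs ∉ xs
  X'-fresh xs X'∈xs = χ'-fresh (map encode xs)
    (subst (_∈ map encode xs) (encode-decode _) (∈-map⁺ encode X'∈xs))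

  X-ι≡X' : (xs : List 𝒱) → X ι xs ≡ X' xs
  X-ι≡X' xs = cong X' (concatMap-pure xs)

  X-ι-fresh : (xs : List 𝒱) → X ι xs ∉ xs
  X-ι-fresh xs = subst (_∉ xs) (sym (X-ι≡X' xs)) (X'-fresh xs)

  X-ι-fresh-via : ∀ xs {ys} → X ι xs ≡ X ι ys → X ι xs ∉ ys
  X-ι-fresh-via _ {ys} eq = subst (_∉ ys) (sym eq) (X-ι-fresh ys)

  renamings-agree : ∀ M x M' x' {y y'} →
                    M [ x := v y ] ≡ M' [ x' := v y' ] → y ≡ y' →
                    M [ x := v y ] ≡ M' [ x' := v y ]
  renamings-agree _ _ _ _ eq refl = eq

  ·-injective : ∀ {M N M' N'} → M · N ≡ M' · N' → M ≡ M' × N ≡ N'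
  ·-injective refl = refl , refl

  lam-injective : ∀ {x A M x' A' M'} → lam x A M ≡ lam x' A' M' → x ≡ x' × A ≡ A' × M ≡ M'
  lam-injective refl = refl , refl , refl

  pi-injective : ∀ {x A B x' A' B'} → pi x A B ≡ pi x' A' B' → x ≡ x' × A ≡ A' × B ≡ B'
  pi-injective refl = refl , refl , refl

  •ι-injective-∼α : (M M' : Λ) → M • ι ≡ M' • ι → M ∼α M'
  •ι-injective-∼α (c k) (c .k) refl = ∼c
  •ι-injective-∼α (v x) (v .x) refl = ∼v
  •ι-injective-∼α (M · N) (M' · N') eq with ·-injective eq
  ... | M≡M' , N≡N' = ∼app (•ι-injective-∼α M M' M≡M') (•ι-injective-∼α N N' N≡N')
  •ι-injective-∼α (lam x A M) (lam x' A' M') eq with lam-injective eq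
  ... | y≡y' , A≡A' , M≡M' =
    ∼lam (•ι-injective-∼α A A' A≡A')
         (X-ι-fresh _) (X-ι-fresh-via (fv M - x) y≡y') (renamings-agree M x M' x' M≡M' y≡y')
  •ι-injective-∼α (pi x A B) (pi x' A' B') eq with pi-injective eq
  ... | y≡y' , A≡A' , B≡B' =
    ∼pi (•ι-injective-∼α A A' A≡A')
        (X-ι-fresh _) (X-ι-fresh-via (fv B - x) y≡y') (renamings-agree B x B' x' B≡B' y≡y')
  •ι-injective-∼α (c _) (v _) ()
  •ι-injective-∼α (c _) (_ · _) ()
  •ι-injective-∼α (c _) (lam _ _ _) ()
  •ι-injective-∼α (c _) (pi _ _ _) ()
  •ι-injective-∼α (v _) (c _) ()
  •ι-injective-∼α (v _) (_ · _) ()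
  •ι-injective-∼α (v _) (lam _ _ _) ()
  •ι-injective-∼α (v _) (pi _ _ _) ()
  •ι-injective-∼α (_ · _) (c _) ()
  •ι-injective-∼α (_ · _) (v _) ()
  •ι-injective-∼α (_ · _) (lam _ _ _) ()
  •ι-injective-∼α (_ · _) (pi _ _ _) ()
  •ι-injective-∼α (lam _ _ _) (c _) ()
  •ι-injective-∼α (lam _ _ _) (v _) ()
  •ι-injective-∼α (lam _ _ _) (_ · _) ()
  •ι-injective-∼α (lam _ _ _) (pi _ _ _) ()
  •ι-injective-∼α (pi _ _ _) (c _) ()
  •ι-injective-∼α (pi _ _ _) (v _) ()
  •ι-injective-∼α (pi _ _ _) (_ · _) ()
  •ι-injective-∼α (pi _ _ _) (lam _ _ _) ()

lemma7 : (𝒱 : Set) (_≟_ : DecidableEquality 𝒱) (encode : 𝒱 → ℕ) (decode : ℕ → 𝒱)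
    (encode-decode : ∀ n → encode (decode n) ≡ n) (𝒞 : Set)
    (χ' : List ℕ → ℕ) (χ'-fresh : ∀ ns → χ' ns ∉ ns) →
    let open Lambda 𝒱 _≟_ encode decode encode-decode 𝒞 χ' χ'-fresh in
    (M M' : Λ) → M • ι ≡ M' • ι → M ∼α M'
lemma7 = CanonicalNames.•ι-injective-∼α
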